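{- Let $L_2$ be the graph with vertex set $\{a,b,c,x,y\}$ and edge set $\{(a,b),(a,c),(b,c),(a,x),(c,x),(b,y),(c,y)\}$, and let $\theta=(\Pi_1,\Pi_2)$ be a rectangle representation of $L_2$. If $\Pi_i(c)\not\subseteq\Pi_i(a)\cap\Pi_i(b)$ for both $i=1$ and $i=2$, then $\theta(c)$ contains a corner point of $\theta(a)\cap\theta(b)$.
   Context: A rectangle representation of a graph $G$ is a map $\theta$ assigning to each vertex $v$ an axis-parallel rectangle $\theta(v)=\Pi_1(v)\times\Pi_2(v)\subseteq\mathbb{R}^2$, where $\Pi_1(v)=[l_1(v),r_1(v)]$ and $\Pi_2(v)=[l_2(v),r_2(v)]$ are closed intervals, such that for distinct vertices $u,v$, $(u,v)$ is an edge of $G$ iff $\theta(u)\cap\theta(v)\neq\emptyset$; we write $\theta=(\Pi_1,\Pi_2)$. For vertices $a,b$ with $\theta(a)\cap\theta(b)\neq\emptyset$, set $l'_k=\max(l_k(a),l_k(b))$ and $r'_k=\min(r_k(a),r_k(b))$ for $k=1,2$; the corner points of $\theta(a)\cap\theta(b)$ are the four (not necessarily distinct) points $(l'_1,l'_2),(l'_1,r'_2),(r'_1,l'_2),(r'_1,r'_2)$. -}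

module Defs where

open import Level using (Level; _⊔_)
open import Data.Product using (Σ; _×_; _,_; ∃)
open import Data.Sum using (_⊎_)
open import Relation.Binary.Bundles using (TotalOrder)
open import Relation.Binary.PropositionalEquality using (_≡_)
open import Relation.Nullary using (¬_)
open import Data.Empty using (⊥)
open import Data.Unit using (⊤)
import Algebra.Construct.NaturalChoice.Min as MinC
import Algebra.Construct.NaturalChoice.Max as MaxC

data V : Set where
  a b c x y : V

E : V → V → Set
E a b = ⊤
E a c = ⊤
E b c = ⊤
E a x = ⊤
E c x = ⊤
E b y = ⊤
E c y = ⊤
E _ _ = ⊥

Adj : V → V → Set
Adj u v = E u v ⊎ E v u

data Dim : Set where
  one two : Dim

-- Coordinates are taken in an arbitrary totally ordered set
-- (ℝ with its usual order is an instance).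
module Rect {c ℓ₁ ℓ₂} (O : TotalOrder c ℓ₁ ℓ₂) where
  open TotalOrder O renaming (Carrier to A)
  open MinC O using (_⊓_)
  open MaxC O renaming (_⊔_ to _⊔ₒ_)

  record Interval : Set (c ⊔ ℓ₂) where
    constructor [_,_∣_]
    field
      l r : A
      l≤r : l ≤ r
  open Interval public

  _∈I_ : A → Interval → Set ℓ₂
  t ∈I I = l I ≤ t × t ≤ r I

  _⊆I_∩_ : Interval → Interval → Interval → Set (c ⊔ ℓ₂)
  I ⊆I J ∩ K = ∀ t → t ∈I I → (t ∈I J × t ∈I K)

  Rectangle : Set (c ⊔ ℓ₂)
  Rectangle = Interval × Interval

  Π : Rectangle → Dim → Interval
  Π (I , J) one = I
  Π (I , J) two = J

  Point : Set c
  Point = A × A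

  _∈R_ : Point → Rectangle → Set ℓ₂
  (p₁ , p₂) ∈R (I , J) = p₁ ∈I I × p₂ ∈I J

  Meets : Rectangle → Rectangle → Set (c ⊔ ℓ₂)
  Meets R S = Σ Point λ p → p ∈R R × p ∈R S

  IsRectRep : (V → Rectangle) → Set (c ⊔ ℓ₂)
  IsRectRep θ = ∀ u v → ¬ (u ≡ v) →
    (Adj u v → Meets (θ u) (θ v)) × (Meets (θ u) (θ v) → Adj u v)

  lb ub : Rectangle → Rectangle → Dim → A
  lb R S k = l (Π R k) ⊔ₒ l (Π S k)
  ub R S k = r (Π R k) ⊓ r (Π S k)

  IsCorner : Rectangle → Rectangle → Point → Set c
  IsCorner R S p =
      p ≡ (lb R S one , lb R S two)
    ⊎ p ≡ (lb R S one , ub R S two)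
    ⊎ p ≡ (ub R S one , lb R S two)
    ⊎ p ≡ (ub R S one , ub R S two)

{-# OPTIONS --safe #-}
module Submission where

open import Defs
open import Data.Product using (Σ; _×_; _,_; proj₁)
open import Data.Sum using (_⊎_; inj₁; inj₂)
open import Data.Unit using (tt)
open import Relation.Binary.Bundles using (TotalOrder)
open import Relation.Binary.PropositionalEquality using (refl)
open import Relation.Nullary using (¬_; contradiction)
import Algebra.Construct.NaturalChoice.Min as Min
import Algebra.Construct.NaturalChoice.Max as Max

-- Work one axis at a time.  Π_k(c) meets both Π_k(a) and Π_k(b), so it reaches
-- up to max(l_k(a), l_k(b)) and down to min(r_k(a), r_k(b)).  If it contained
-- neither of these two endpoints, it would lie between them and hence inside
-- Π_k(a) ∩ Π_k(b).  So on each axis θ(c) contains one of the two endpoints, and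
-- the two choices together form a corner.

module CornerLemma {o ℓ₁ ℓ₂} (O : TotalOrder o ℓ₁ ℓ₂) where
  open TotalOrder O renaming (Carrier to A) hiding (refl)
  open Min O using (_⊓_; ⊓-glb; x⊓y≤x; x⊓y≤y)
  open Max O using (⊔-lub; x≤x⊔y; x≤y⊔x) renaming (_⊔_ to _⊔ₒ_)
  open Rect O

  common-point⇒l≤r : ∀ {s : A} (I J : Interval) → s ∈I I → s ∈I J → l I ≤ r J
  common-point⇒l≤r _ _ (lI≤s , _) (_ , s≤rJ) = trans lI≤s s≤rJ

  ⊆I-∩-between : ∀ (I J K : Interval) →
    l I ⊔ₒ l J ≤ l K → r K ≤ r I ⊓ r J → K ⊆I I ∩ J
  ⊆I-∩-between I J _ lo≤lK rK≤hi t (lK≤t , t≤rK) =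
      (trans (x≤x⊔y (l I) (l J)) lo≤t , trans t≤hi (x⊓y≤x (r I) (r J)))
    , (trans (x≤y⊔x (l I) (l J)) lo≤t , trans t≤hi (x⊓y≤y (r I) (r J)))
    where
      lo≤t : l I ⊔ₒ l J ≤ t
      lo≤t = trans lo≤lK lK≤t
      t≤hi : t ≤ r I ⊓ r J
      t≤hi = trans t≤rK rK≤hi

  meets-both⇒endpoint∈I : ∀ {s t : A} (I J K : Interval) →
    s ∈I I → s ∈I K → t ∈I J → t ∈I K → ¬ (K ⊆I I ∩ J) →
    (l I ⊔ₒ l J) ∈I K ⊎ (r I ⊓ r J) ∈I K
  meets-both⇒endpoint∈I I J K s∈I s∈K t∈J t∈K K⊈I∩J
    with total (l K) (l I ⊔ₒ l J)
  ... | inj₁ lK≤lo =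
    inj₁ (lK≤lo , ⊔-lub (common-point⇒l≤r I K s∈I s∈K) (common-point⇒l≤r J K t∈J t∈K))
  ... | inj₂ lo≤lK with total (r I ⊓ r J) (r K)
  ...   | inj₁ hi≤rK =
    inj₂ (⊓-glb (common-point⇒l≤r K I s∈K s∈I) (common-point⇒l≤r K J t∈K t∈J) , hi≤rK)
  ...   | inj₂ rK≤hi = contradiction (⊆I-∩-between I J K lo≤lK rK≤hi) K⊈I∩J

  meets-both⇒corner∈R : ∀ (R S T : Rectangle) → Meets R T → Meets S T →
    (∀ k → ¬ (Π T k ⊆I Π R k ∩ Π S k)) →
    Σ Point λ p → IsCorner R S p × p ∈R T
  meets-both⇒corner∈R (I₁ , I₂) (J₁ , J₂) (K₁ , K₂)
                      (_ , (s₁∈I₁ , s₂∈I₂) , (s₁∈K₁ , s₂∈K₂))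
                      (_ , (t₁∈J₁ , t₂∈J₂) , (t₁∈K₁ , t₂∈K₂)) T⊈R∩S
    with meets-both⇒endpoint∈I I₁ J₁ K₁ s₁∈I₁ s₁∈K₁ t₁∈J₁ t₁∈K₁ (T⊈R∩S one)
       | meets-both⇒endpoint∈I I₂ J₂ K₂ s₂∈I₂ s₂∈K₂ t₂∈J₂ t₂∈K₂ (T⊈R∩S two)
  ... | inj₁ p₁ | inj₁ p₂ = _ , inj₁ refl , p₁ , p₂
  ... | inj₁ p₁ | inj₂ p₂ = _ , inj₂ (inj₁ refl) , p₁ , p₂
  ... | inj₂ p₁ | inj₁ p₂ = _ , inj₂ (inj₂ (inj₁ refl)) , p₁ , p₂
  ... | inj₂ p₁ | inj₂ p₂ = _ , inj₂ (inj₂ (inj₂ refl)) , p₁ , p₂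

lemma5 : ∀ {o ℓ₁ ℓ₂} (O : TotalOrder o ℓ₁ ℓ₂) → let open Rect O in
    (θ : V → Rectangle) → IsRectRep θ →
    (∀ (i : Dim) → ¬ (Π (θ c) i ⊆I Π (θ a) i ∩ Π (θ b) i)) →
    Σ Point λ p → IsCorner (θ a) (θ b) p × p ∈R θ c
lemma5 O θ rep c⊈a∩b =
  CornerLemma.meets-both⇒corner∈R O (θ a) (θ b) (θ c)
    (proj₁ (rep a c (λ ())) (inj₁ tt))
    (proj₁ (rep b c (λ ())) (inj₁ tt))
    c⊈a∩b
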